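{- A graph $G$ belongs to the upper bipartite chain switching class if and only if $G$ is $\{\overline{C_4}, K_3+K_1, K_4\}$-free and $G$ belongs to the upper bipartite switching class.
   Context: All graphs are finite and simple. For a graph $G$ and $A\subseteq V(G)$, the switching $S(G,A)$ is the graph on $V(G)$ whose edges are the edges of $G$ with both ends in $A$, the edges of $G$ with both ends outside $A$, and all pairs $uv$ with $u\in A$, $v\notin A$, $uv\notin E(G)$. For a graph class $\mathcal{G}$, the upper $\mathcal{G}$ switching class is the class of graphs $G$ such that $S(G,A)$ is in $\mathcal{G}$ for some $A\subseteq V(G)$. A bipartite chain graph is a bipartite graph with a bipartition $(L,R)$ such that the neighborhoods of the vertices of $L$ are linearly ordered by inclusion. $\overline{C_4}$ is the complement of the 4-cycle (two disjoint edges), $K_3+K_1$ is the disjoint union of a triangle and an isolated vertex, $K_4$ is the complete graph on four vertices; a graph is $\mathcal{H}$-free if it has no induced subgraph isomorphic to a member of $\mathcal{H}$. -}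

module Defs where

open import Data.Nat using (ℕ)
open import Data.Fin using (Fin; zero; suc)
open import Data.Bool using (Bool; true; false; not; _xor_; if_then_else_)
open import Data.Product using (Σ; ∃; _×_; _,_)
open import Data.Sum using (_⊎_)
open import Relation.Nullary using (¬_)
open import Relation.Binary.PropositionalEquality using (_≡_; _≢_)
open import Function.Definitions using (Injective)

record Graph (n : ℕ) : Set where
  field
    adj     : Fin n → Fin n → Bool
    adj-sym : ∀ u v → adj u v ≡ adj v u
    adj-irr : ∀ u → adj u u ≡ false
open Graph public

VSubset : ℕ → Set
VSubset n = Fin n → Bool

-- Switching S(G,A): u ~ v iff (u,v on the same side of A and uv ∈ E(G))
-- or (u,v on different sides and uv ∉ E(G)).  Equivalently the new
-- adjacency is adj u v xor (A u xor A v).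
switchAdj : ∀ {n} → Graph n → VSubset n → Fin n → Fin n → Bool
switchAdj G A u v = adj G u v xor (A u xor A v)

GraphClass : Set₁
GraphClass = ∀ {n} → Graph n → Set

UpperSwitching : GraphClass → GraphClass
UpperSwitching 𝒢 {n} G =
  Σ (VSubset n) λ A → Σ (Graph n) λ H →
    (∀ u v → adj H u v ≡ switchAdj G A u v) × 𝒢 H

-- Bipartite: there is a bipartition (side false = L, side true = R)
-- with every edge joining the two sides.
IsBipartition : ∀ {n} → Graph n → (Fin n → Bool) → Set
IsBipartition G side = ∀ u v → adj G u v ≡ true → side u ≢ side v

Bipartite : GraphClass
Bipartite {n} G = Σ (Fin n → Bool) λ side → IsBipartition G side

NbhdSubset : ∀ {n} → Graph n → Fin n → Fin n → Set
NbhdSubset G u v = ∀ w → adj G u w ≡ true → adj G v w ≡ true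

BipartiteChain : GraphClass
BipartiteChain {n} G = Σ (Fin n → Bool) λ side → IsBipartition G side ×
  (∀ u v → side u ≡ false → side v ≡ false →
     NbhdSubset G u v ⊎ NbhdSubset G v u)

InducedSub : ∀ {k n} → Graph k → Graph n → Set
InducedSub {k} {n} H G = Σ (Fin k → Fin n) λ f → Injective _≡_ _≡_ f ×
  (∀ i j → adj H i j ≡ adj G (f i) (f j))

-- Small graphs on Fin 4.
-- complement of C4 = two disjoint edges {0,1}, {2,3}
coC4-adj : Fin 4 → Fin 4 → Bool
coC4-adj zero (suc zero) = true
coC4-adj (suc zero) zero = true
coC4-adj (suc (suc zero)) (suc (suc (suc zero))) = true
coC4-adj (suc (suc (suc zero))) (suc (suc zero)) = true
coC4-adj _ _ = false

coC4 : Graph 4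
coC4 = record { adj = coC4-adj ; adj-sym = s ; adj-irr = r }
  where
  s : ∀ u v → coC4-adj u v ≡ coC4-adj v u
  s zero zero = _≡_.refl
  s zero (suc zero) = _≡_.refl
  s zero (suc (suc zero)) = _≡_.refl
  s zero (suc (suc (suc zero))) = _≡_.refl
  s (suc zero) zero = _≡_.refl
  s (suc zero) (suc zero) = _≡_.refl
  s (suc zero) (suc (suc zero)) = _≡_.refl
  s (suc zero) (suc (suc (suc zero))) = _≡_.refl
  s (suc (suc zero)) zero = _≡_.refl
  s (suc (suc zero)) (suc zero) = _≡_.refl
  s (suc (suc zero)) (suc (suc zero)) = _≡_.refl
  s (suc (suc zero)) (suc (suc (suc zero))) = _≡_.refl
  s (suc (suc (suc zero))) zero = _≡_.refl
  s (suc (suc (suc zero))) (suc zero) = _≡_.refl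
  s (suc (suc (suc zero))) (suc (suc zero)) = _≡_.refl
  s (suc (suc (suc zero))) (suc (suc (suc zero))) = _≡_.refl
  r : ∀ u → coC4-adj u u ≡ false
  r zero = _≡_.refl
  r (suc zero) = _≡_.refl
  r (suc (suc zero)) = _≡_.refl
  r (suc (suc (suc zero))) = _≡_.refl

K3K1-adj : Fin 4 → Fin 4 → Bool
K3K1-adj (suc (suc (suc zero))) _ = false
K3K1-adj _ (suc (suc (suc zero))) = false
K3K1-adj zero zero = false
K3K1-adj (suc zero) (suc zero) = false
K3K1-adj (suc (suc zero)) (suc (suc zero)) = false
K3K1-adj _ _ = true

K3K1 : Graph 4
K3K1 = record { adj = K3K1-adj ; adj-sym = s ; adj-irr = r }
  where
  s : ∀ u v → K3K1-adj u v ≡ K3K1-adj v u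
  s zero zero = _≡_.refl
  s zero (suc zero) = _≡_.refl
  s zero (suc (suc zero)) = _≡_.refl
  s zero (suc (suc (suc zero))) = _≡_.refl
  s (suc zero) zero = _≡_.refl
  s (suc zero) (suc zero) = _≡_.refl
  s (suc zero) (suc (suc zero)) = _≡_.refl
  s (suc zero) (suc (suc (suc zero))) = _≡_.refl
  s (suc (suc zero)) zero = _≡_.refl
  s (suc (suc zero)) (suc zero) = _≡_.refl
  s (suc (suc zero)) (suc (suc zero)) = _≡_.refl
  s (suc (suc zero)) (suc (suc (suc zero))) = _≡_.refl
  s (suc (suc (suc zero))) zero = _≡_.refl
  s (suc (suc (suc zero))) (suc zero) = _≡_.refl
  s (suc (suc (suc zero))) (suc (suc zero)) = _≡_.refl
  s (suc (suc (suc zero))) (suc (suc (suc zero))) = _≡_.refl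
  r : ∀ u → K3K1-adj u u ≡ false
  r zero = _≡_.refl
  r (suc zero) = _≡_.refl
  r (suc (suc zero)) = _≡_.refl
  r (suc (suc (suc zero))) = _≡_.refl

K4-adj : Fin 4 → Fin 4 → Bool
K4-adj zero zero = false
K4-adj (suc zero) (suc zero) = false
K4-adj (suc (suc zero)) (suc (suc zero)) = false
K4-adj (suc (suc (suc zero))) (suc (suc (suc zero))) = false
K4-adj _ _ = true

K4 : Graph 4
K4 = record { adj = K4-adj ; adj-sym = s ; adj-irr = r }
  where
  s : ∀ u v → K4-adj u v ≡ K4-adj v u
  s zero zero = _≡_.refl
  s zero (suc zero) = _≡_.refl
  s zero (suc (suc zero)) = _≡_.refl
  s zero (suc (suc (suc zero))) = _≡_.refl
  s (suc zero) zero = _≡_.refl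
  s (suc zero) (suc zero) = _≡_.refl
  s (suc zero) (suc (suc zero)) = _≡_.refl
  s (suc zero) (suc (suc (suc zero))) = _≡_.refl
  s (suc (suc zero)) zero = _≡_.refl
  s (suc (suc zero)) (suc zero) = _≡_.refl
  s (suc (suc zero)) (suc (suc zero)) = _≡_.refl
  s (suc (suc zero)) (suc (suc (suc zero))) = _≡_.refl
  s (suc (suc (suc zero))) zero = _≡_.refl
  s (suc (suc (suc zero))) (suc zero) = _≡_.refl
  s (suc (suc (suc zero))) (suc (suc zero)) = _≡_.refl
  s (suc (suc (suc zero))) (suc (suc (suc zero))) = _≡_.refl
  r : ∀ u → K4-adj u u ≡ false
  r zero = _≡_.refl
  r (suc zero) = _≡_.refl
  r (suc (suc zero)) = _≡_.refl
  r (suc (suc (suc zero))) = _≡_.refl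

ForbiddenFree : ∀ {n} → Graph n → Set
ForbiddenFree G = ¬ InducedSub coC4 G × ¬ InducedSub K3K1 G × ¬ InducedSub K4 G

{-# OPTIONS --safe #-}
module Submission where

-- On four vertices the switching class of 2K₂ = co-C₄ consists of 2K₂,
-- K₃+K₁ and K₄, so the forbidden family is closed under switching and
-- {co-C₄, K₃+K₁, K₄}-freeness is a switching invariant.  A bipartite graph
-- has no triangle, hence no K₃+K₁ or K₄, and its bipartition is a chain
-- bipartition iff it has no induced 2K₂: two vertices of L with incomparable
-- neighbourhoods, together with private neighbours, induce a 2K₂.  Hence a
-- bipartite chain switching S(G,A) is forbidden-free and so is G; conversely
-- if G is forbidden-free and S(G,A) is bipartite, then S(G,A) is
-- forbidden-free, in particular 2K₂-free, so its bipartition is a chain one.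

open import Defs
open import Data.Nat using (ℕ; zero; suc)
open import Data.Fin using (Fin; _≟_)
open import Data.Fin.Patterns using (0F; 1F; 2F; 3F)
open import Data.Fin.Properties using (any?; all?)
open import Data.Fin.Subset using (Subset)
open import Data.Fin.Subset.Properties using (anySubset?)
open import Data.Bool using (Bool; true; false; not; _xor_)
open import Data.Bool.Properties as Bool
  using (xor-comm; xor-same; xor-assoc; xor-identityʳ; ¬-not; not-involutive)
open import Data.Vec using (Vec; []; _∷_; lookup; tabulate)
open import Data.Vec.Properties using (lookup∘tabulate)
open import Data.Empty using (⊥; ⊥-elim)
open import Data.Product using (∃; _×_; _,_; proj₁)
open import Data.Sum using (_⊎_; inj₁; inj₂; [_,_])
import Data.Sum as Sum
open import Function using (_∘_; id; flip)
open import Function.Bundles using (_⇔_; mk⇔)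
open import Relation.Nullary using (¬_; Dec; yes; no; ¬?; contradiction)
open import Relation.Nullary.Decidable
  using (map′; True; toWitness; _×-dec_; _⊎-dec_; _→-dec_; decidable-stable)
open import Relation.Binary.PropositionalEquality
  using (_≡_; refl; sym; trans; cong; cong₂; ≢-sym; module ≡-Reasoning)

private
  variable
    k n : ℕ

-- A record rather than a function type, so that G, A and H are inferable from a proof.
record IsSwitching (G : Graph n) (A : VSubset n) (H : Graph n) : Set where
  constructor switching
  field adj-switch : ∀ u v → adj H u v ≡ switchAdj G A u v

switch : Graph n → VSubset n → Graph n
switch G A = record
  { adj     = switchAdj G A
  ; adj-sym = λ u v → cong₂ _xor_ (adj-sym G u v) (xor-comm (A u) (A v))
  ; adj-irr = λ u → cong₂ _xor_ (adj-irr G u) (xor-same (A u))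
  }

isSwitching-sym : ∀ {G H : Graph n} {A} → IsSwitching G A H → IsSwitching H A G
isSwitching-sym {G = G} {H} {A} (switching H≡) = switching λ u v →
  let c = A u xor A v in begin
    adj G u v                ≡⟨ sym (xor-identityʳ _) ⟩
    adj G u v xor false      ≡⟨ cong (adj G u v xor_) (sym (xor-same c)) ⟩
    adj G u v xor (c xor c)  ≡⟨ sym (xor-assoc (adj G u v) c c) ⟩
    (adj G u v xor c) xor c  ≡⟨ cong (_xor c) (sym (H≡ u v)) ⟩
    adj H u v xor c          ∎
  where open ≡-Reasoning

inducedSub-trans : ∀ {m} {F : Graph k} {G : Graph n} {K : Graph m} →
  InducedSub F G → InducedSub G K → InducedSub F K
inducedSub-trans (f , f-inj , f-adj) (g , g-inj , g-adj) =
  g ∘ f , f-inj ∘ g-inj , λ i j → trans (f-adj i j) (g-adj (f i) (f j))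

inducedSub-switch : ∀ {F : Graph k} {G H : Graph n} {A} →
  InducedSub F G → IsSwitching G A H → ∃ λ B → InducedSub (switch F B) H
inducedSub-switch {A = A} (f , f-inj , f-adj) (switching H≡) =
  A ∘ f , f , f-inj , λ i j → trans (cong (_xor _) (f-adj i j)) (sym (H≡ (f i) (f j)))

switch-tabulate : (F : Graph n) (B : VSubset n) →
  InducedSub (switch F (lookup (tabulate B))) (switch F B)
switch-tabulate F B = id , id , λ i j →
  cong₂ (λ x y → adj F i j xor (x xor y)) (lookup∘tabulate B i) (lookup∘tabulate B j)

FullHom : Graph k → Graph n → (Fin k → Fin n) → Set
FullHom F G f = ∀ i j → adj F i j ≡ adj G (f i) (f j)

fullHom? : (F : Graph k) (G : Graph n) (f : Fin k → Fin n) → Dec (FullHom F G f)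
fullHom? F G f = all? λ i → all? λ j → adj F i j Bool.≟ adj G (f i) (f j)

PointDetermining : Graph n → Set
PointDetermining G = ∀ u v → (∀ w → adj G u w ≡ adj G v w) → u ≡ v

pointDetermining? : (G : Graph n) → Dec (PointDetermining G)
pointDetermining? G =
  all? λ u → all? λ v → all? (λ w → adj G u w Bool.≟ adj G v w) →-dec u ≟ v

fullHom⇒inducedSub : ∀ {F : Graph k} {G : Graph n} {f} →
  PointDetermining F → FullHom F G f → InducedSub F G
fullHom⇒inducedSub {F = F} {G} {f} F-pd f-adj = f , f-inj , f-adj
  where
  f-inj : ∀ {i j} → f i ≡ f j → i ≡ j
  f-inj {i} {j} fi≡fj = F-pd i j λ w → begin
    adj F i w          ≡⟨ f-adj i w ⟩
    adj G (f i) (f w)  ≡⟨ cong (λ x → adj G x (f w)) fi≡fj ⟩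
    adj G (f j) (f w)  ≡⟨ sym (f-adj j w) ⟩
    adj F j w          ∎
    where open ≡-Reasoning

HasForbidden : Graph n → Set
HasForbidden G = InducedSub coC4 G ⊎ InducedSub K3K1 G ⊎ InducedSub K4 G

forbiddenFree⇒¬hasForbidden : {G : Graph n} → ForbiddenFree G → ¬ HasForbidden G
forbiddenFree⇒¬hasForbidden (¬coC4 , ¬K3K1 , ¬K4) = [ ¬coC4 , [ ¬K3K1 , ¬K4 ] ]

hasForbidden-mono : {K : Graph k} {G : Graph n} →
  HasForbidden K → InducedSub K G → HasForbidden G
hasForbidden-mono {K = K} {G} K-has K⊆G =
  Sum.map (into coC4) (Sum.map (into K3K1) (into K4)) K-has
  where
  into : (F : Graph 4) → InducedSub F K → InducedSub F G
  into F F⊆K = inducedSub-trans {F = F} {K} {G} F⊆K K⊆G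

anyVec? : {P : Vec (Fin n) k → Set} → (∀ v → Dec (P v)) → Dec (∃ P)
anyVec? {k = zero}  P? = map′ ([] ,_) (λ { ([] , p) → p }) (P? [])
anyVec? {k = suc k} P? =
  map′ (λ (x , v , p) → x ∷ v , p) (λ { (x ∷ v , p) → x , v , p })
    (any? λ x → anyVec? λ v → P? (x ∷ v))

allSubset? : {P : Subset n → Set} → (∀ p → Dec (P p)) → Dec (∀ p → P p)
allSubset? P? = map′ (λ ¬∃¬ p → decidable-stable (P? p) (λ ¬Pp → ¬∃¬ (p , ¬Pp)))
  (λ ∀P (p , ¬Pp) → ¬Pp (∀P p)) (¬? (anySubset? (¬? ∘ P?)))

-- A map is given by its table of values, so that it can be searched for.
FullHomTo : Graph k → Graph n → Set
FullHomTo {k} {n} F G = ∃ λ (v : Vec (Fin n) k) → FullHom F G (lookup v)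

fullHomTo? : (F : Graph k) (G : Graph n) → Dec (FullHomTo F G)
fullHomTo? F G = anyVec? (fullHom? F G ∘ lookup)

ForbiddenHomTo : Graph n → Set
ForbiddenHomTo G = FullHomTo coC4 G ⊎ FullHomTo K3K1 G ⊎ FullHomTo K4 G

forbiddenHomTo? : (G : Graph n) → Dec (ForbiddenHomTo G)
forbiddenHomTo? G = fullHomTo? coC4 G ⊎-dec fullHomTo? K3K1 G ⊎-dec fullHomTo? K4 G

fullHomTo⇒inducedSub : (F : Graph k) {_ : True (pointDetermining? F)} {G : Graph n} →
  FullHomTo F G → InducedSub F G
fullHomTo⇒inducedSub F {F-pd} {G} (_ , hom) =
  fullHom⇒inducedSub {F = F} {G} (toWitness F-pd) hom

forbiddenHomTo⇒hasForbidden : {G : Graph n} → ForbiddenHomTo G → HasForbidden G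
forbiddenHomTo⇒hasForbidden {G = G} =
  Sum.map (fullHomTo⇒inducedSub coC4 {G = G})
    (Sum.map (fullHomTo⇒inducedSub K3K1 {G = G}) (fullHomTo⇒inducedSub K4 {G = G}))

-- The implicit argument is found by evaluation: an exhaustive search over the
-- 16 switching sets and the 256 maps Fin 4 → Fin 4.
switchings-hasForbidden : (F : Graph 4) →
  {True (allSubset? (forbiddenHomTo? ∘ switch F ∘ lookup))} →
  ∀ B → HasForbidden (switch F B)
switchings-hasForbidden F {table} B =
  hasForbidden-mono {K = F′} {switch F B}
    (forbiddenHomTo⇒hasForbidden {G = F′} (toWitness table (tabulate B))) (switch-tabulate F B)
  where F′ = switch F (lookup (tabulate B))

hasForbidden-switch : ∀ {G H : Graph n} {A} →
  HasForbidden G → IsSwitching G A H → HasForbidden H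
hasForbidden-switch {G = G} {H} G-has H≡ =
  [ via coC4 (switchings-hasForbidden coC4) ,
  [ via K3K1 (switchings-hasForbidden K3K1) ,
    via K4 (switchings-hasForbidden K4) ] ] G-has
  where
  via : (F : Graph 4) → (∀ B → HasForbidden (switch F B)) → InducedSub F G → HasForbidden H
  via F switchings F⊆G with inducedSub-switch {F = F} F⊆G H≡
  ... | B , FB⊆H = hasForbidden-mono {K = switch F B} {H} (switchings B) FB⊆H

forbiddenFree-switch : ∀ {G H : Graph n} {A} →
  ForbiddenFree G → IsSwitching G A H → ForbiddenFree H
forbiddenFree-switch {G = G} {H} G-free H≡ =
  excluded ∘ inj₁ , excluded ∘ inj₂ ∘ inj₁ , excluded ∘ inj₂ ∘ inj₂
  where
  excluded : ¬ HasForbidden H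
  excluded =
    forbiddenFree⇒¬hasForbidden {G = G} G-free ∘ flip hasForbidden-switch (isSwitching-sym H≡)

NestedNeighbourhoods : Graph n → (Fin n → Bool) → Set
NestedNeighbourhoods H side =
  ∀ u v → side u ≡ false → side v ≡ false → NbhdSubset H u v ⊎ NbhdSubset H v u

module _ (H : Graph n) {side : Fin n → Bool} (bip : IsBipartition H side) where

  otherSide : ∀ {u v} → adj H u v ≡ true → side v ≡ not (side u)
  otherSide {u} {v} uv = ¬-not (≢-sym (bip u v uv))

  sameSide⇒nonadjacent : ∀ {u v} → side u ≡ side v → adj H u v ≡ false
  sameSide⇒nonadjacent {u} {v} su≡sv = ¬-not λ uv → bip u v uv su≡sv

  bipartite-triangleFree : ∀ {x y z} →
    adj H x y ≡ true → adj H y z ≡ true → adj H x z ≡ true → ⊥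
  bipartite-triangleFree {x} {y} {z} xy yz xz = bip x z xz (begin
    side x              ≡⟨ sym (not-involutive _) ⟩
    not (not (side x))  ≡⟨ cong not (sym (otherSide xy)) ⟩
    not (side y)        ≡⟨ sym (otherSide yz) ⟩
    side z              ∎)
    where open ≡-Reasoning

  ¬inducedSub-triangle : (F : Graph k) (x y z : Fin k) →
    adj F x y ≡ true → adj F y z ≡ true → adj F x z ≡ true → ¬ InducedSub F H
  ¬inducedSub-triangle F x y z xy yz xz (f , _ , f-adj) = bipartite-triangleFree
    (trans (sym (f-adj x y)) xy) (trans (sym (f-adj y z)) yz) (trans (sym (f-adj x z)) xz)

  nested⇒no2K2 : NestedNeighbourhoods H side → ∀ {x x′ y y′} →
    side x ≡ false → side y ≡ false → adj H x x′ ≡ true → adj H y y′ ≡ true →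
    adj H x y′ ≡ false → adj H y x′ ≡ false → ⊥
  nested⇒no2K2 nested {x} {x′} {y} {y′} sx sy xx′ yy′ xy′ yx′ with nested x y sx sy
  ... | inj₁ Nx⊆Ny = contradiction (trans (sym (Nx⊆Ny x′ xx′)) yx′) λ ()
  ... | inj₂ Ny⊆Nx = contradiction (trans (sym (Ny⊆Nx y′ yy′)) xy′) λ ()

  -- The case split orients each edge of the 2K₂ from its endpoint on side false.
  nested⇒¬coC4 : NestedNeighbourhoods H side → ¬ InducedSub coC4 H
  nested⇒¬coC4 nested (f , _ , f-adj) = bySides refl refl
    where
    e : ∀ i j → adj H (f i) (f j) ≡ adj coC4 i j
    e i j = sym (f-adj i j)
    leave : ∀ {u v} → adj H u v ≡ true → side u ≡ true → side v ≡ false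
    leave uv su = trans (otherSide uv) (cong not su)
    bySides : ∀ {b₀ b₂} → side (f 0F) ≡ b₀ → side (f 2F) ≡ b₂ → ⊥
    bySides {false} {false} s₀ s₂ =
      nested⇒no2K2 nested s₀ s₂ (e 0F 1F) (e 2F 3F) (e 0F 3F) (e 2F 1F)
    bySides {false} {true}  s₀ s₂ =
      nested⇒no2K2 nested s₀ (leave (e 2F 3F) s₂) (e 0F 1F) (e 3F 2F) (e 0F 2F) (e 3F 1F)
    bySides {true}  {false} s₀ s₂ =
      nested⇒no2K2 nested (leave (e 0F 1F) s₀) s₂ (e 1F 0F) (e 2F 3F) (e 1F 3F) (e 2F 0F)
    bySides {true}  {true}  s₀ s₂ =
      nested⇒no2K2 nested (leave (e 0F 1F) s₀) (leave (e 2F 3F) s₂)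
        (e 1F 0F) (e 3F 2F) (e 1F 2F) (e 3F 0F)

  nested⇒forbiddenFree : NestedNeighbourhoods H side → ForbiddenFree H
  nested⇒forbiddenFree nested =
    nested⇒¬coC4 nested ,
    ¬inducedSub-triangle K3K1 0F 1F 2F refl refl refl ,
    ¬inducedSub-triangle K4 0F 1F 2F refl refl refl

  induced2K2 : ∀ {u v w w′} → side u ≡ side v →
    adj H u w ≡ true → adj H v w ≡ false → adj H v w′ ≡ true → adj H u w′ ≡ false →
    InducedSub coC4 H
  induced2K2 {u} {v} {w} {w′} su≡sv uw vw vw′ uw′ =
    fullHomTo⇒inducedSub coC4 {G = H} (u ∷ w ∷ v ∷ w′ ∷ [] , λ i j → sym (hom i j))
    where
    g : Fin 4 → Fin n
    g = lookup (u ∷ w ∷ v ∷ w′ ∷ [])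
    uv : adj H u v ≡ false
    uv = sameSide⇒nonadjacent su≡sv
    ww′ : adj H w w′ ≡ false
    ww′ = sameSide⇒nonadjacent
      (trans (otherSide uw) (trans (cong not su≡sv) (sym (otherSide vw′))))
    flipped : ∀ {a b x} → adj H a b ≡ x → adj H b a ≡ x
    flipped {a} {b} = trans (adj-sym H b a)
    hom : ∀ i j → adj H (g i) (g j) ≡ adj coC4 i j
    hom 0F 0F = adj-irr H u
    hom 0F 1F = uw
    hom 0F 2F = uv
    hom 0F 3F = uw′
    hom 1F 0F = flipped uw
    hom 1F 1F = adj-irr H w
    hom 1F 2F = flipped vw
    hom 1F 3F = ww′
    hom 2F 0F = flipped uv
    hom 2F 1F = vw
    hom 2F 2F = adj-irr H v
    hom 2F 3F = vw′
    hom 3F 0F = flipped uw′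
    hom 3F 1F = flipped ww′
    hom 3F 2F = flipped vw′
    hom 3F 3F = adj-irr H w′

  nbhdSubset⊎privateNeighbour : ∀ u v →
    NbhdSubset H u v ⊎ ∃ λ w → adj H u w ≡ true × adj H v w ≡ false
  nbhdSubset⊎privateNeighbour u v
    with any? (λ w → (adj H u w Bool.≟ true) ×-dec (adj H v w Bool.≟ false))
  ... | yes witness = inj₂ witness
  ... | no none     = inj₁ λ w uw → ¬-not λ vw → none (w , uw , vw)

  coC4Free⇒nested : ¬ InducedSub coC4 H → NestedNeighbourhoods H side
  coC4Free⇒nested no2K2 u v su sv
    with nbhdSubset⊎privateNeighbour u v | nbhdSubset⊎privateNeighbour v u
  ... | inj₁ u⊆v | _        = inj₁ u⊆v
  ... | inj₂ _   | inj₁ v⊆u = inj₂ v⊆u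
  ... | inj₂ (w , uw , vw) | inj₂ (w′ , vw′ , uw′) =
    ⊥-elim (no2K2 (induced2K2 (trans su (sym sv)) uw vw vw′ uw′))

mainTheorem7 : ∀ {n : ℕ} (G : Graph n) →
    UpperSwitching BipartiteChain G ⇔ (ForbiddenFree G × UpperSwitching Bipartite G)
mainTheorem7 G = mk⇔
  (λ (A , H , H≡ , side , bip , nested) →
    let H-switch = switching {G = G} {A} {H} H≡ in
    forbiddenFree-switch (nested⇒forbiddenFree H bip nested) (isSwitching-sym H-switch) ,
    A , H , H≡ , side , bip)
  (λ (G-free , A , H , H≡ , side , bip) →
    let H-switch = switching {G = G} {A} {H} H≡ in
    A , H , H≡ , side , bip ,
    coC4Free⇒nested H bip (proj₁ (forbiddenFree-switch G-free H-switch)))
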